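{- For $n\ge1$ and positive integers $a_1,\dots,a_{n+1},b_1,\dots,b_n$, \[ \sum_{\sigma\in\mathfrak S_{n+1}}\mathrm{sgn}(\sigma)\,x_{a_{\sigma(1)}}x_{b_1}x_{a_{\sigma(2)}}x_{b_2}\cdots x_{a_{\sigma(n)}}x_{b_n}x_{a_{\sigma(n+1)}}\in\mathfrak X^+\diamond\mathfrak X^+ . \]
   Context: $\mathfrak X=\mathbb Q\langle x_1,x_2,\dots\rangle$ is the free non-commutative $\mathbb Q$-algebra, $\mathfrak X^+$ the span of all non-empty monomials. For $k\ge0$, $s_k$ is the linear map with $s_k(x_iw)=x_{i+k}w$, $s_k(1)=0$. The block shuffle product $\diamond$ is the bilinear map with $u\diamond1=1\diamond u=u$ and $x_au\diamond x_bv=x_a(u\diamond x_bv)+x_b(x_au\diamond v)-s_{a+b}(u\diamond v)$. $\mathfrak X^+\diamond\mathfrak X^+$ is the $\mathbb Q$-span of $\{u\diamond v:u,v\in\mathfrak X^+\}$. -}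

module Defs where

open import Data.Nat using (ℕ; zero; suc; _+_; _≤_; _<ᵇ_)
open import Data.Nat.Properties using () renaming (_≟_ to _≟ℕ_)
open import Data.Rational using (ℚ; 0ℚ; 1ℚ; -_) renaming (_+_ to _+ℚ_; _*_ to _*ℚ_)
open import Data.Fin using (Fin; zero; suc; toℕ)
open import Data.Fin.Properties using () renaming (_≟_ to _≟F_)
open import Data.List using (List; []; _∷_; _++_; map; concatMap; foldr; length; filter; cartesianProductWith; allFin)
open import Data.Bool.ListAction using (any)
open import Data.List.Properties using (≡-dec)
open import Data.List.Relation.Unary.All using (All)
open import Data.Vec using (Vec; []; _∷_; lookup; toList)
open import Data.Product using (_×_; _,_; ∃)
open import Data.Bool using (Bool; true; false; not; _∧_; if_then_else_)
open import Relation.Nullary.Decidable using (does)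
open import Relation.Binary.PropositionalEquality using (_≡_)
open import Function using (_∘_)

-- The free non-commutative ℚ-algebra 𝔛 = ℚ⟨x₁,x₂,…⟩.
-- A letter is a natural number i, standing for x_i; membership in 𝔛
-- requires i ≥ 1 (see `InX⁺`).  A monomial is a word (list of letters),
-- the empty word being the unit 1.  An element of the algebra is a
-- formal finite ℚ-linear combination of words, represented as a list of
-- (coefficient , word) pairs; two such lists denote the same element iff
-- all their coefficients agree (`_≈_`).

Word : Set
Word = List ℕ

Poly : Set
Poly = List (ℚ × Word)

_≟W_ : (u v : Word) → Relation.Nullary.Decidable.Dec (u ≡ v)
_≟W_ = ≡-dec _≟ℕ_
  where import Relation.Nullary.Decidable

coeff : Poly → Word → ℚ
coeff []             w = 0ℚ
coeff ((c , u) ∷ p) w = if does (u ≟W w) then c +ℚ coeff p w else coeff p w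

infix 4 _≈_
_≈_ : Poly → Poly → Set
p ≈ q = ∀ w → coeff p w ≡ coeff q w

scale : ℚ → Poly → Poly
scale c = map (λ { (d , w) → (c *ℚ d , w) })

prefix : ℕ → Poly → Poly
prefix a = map (λ { (c , w) → (c , a ∷ w) })

s : ℕ → Poly → Poly
s k = concatMap step
  where
  step : ℚ × Word → Poly
  step (c , [])    = []
  step (c , i ∷ w) = (c , (i + k) ∷ w) ∷ []

_⋄ʷ_ : Word → Word → Poly
[]      ⋄ʷ v       = (1ℚ , v) ∷ []
(a ∷ u) ⋄ʷ []      = (1ℚ , a ∷ u) ∷ []
(a ∷ u) ⋄ʷ (b ∷ v) =
  prefix a (u ⋄ʷ (b ∷ v)) ++ prefix b ((a ∷ u) ⋄ʷ v) ++ scale (- 1ℚ) (s (a + b) (u ⋄ʷ v))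

_⋄_ : Poly → Poly → Poly
p ⋄ q = concatMap (λ { (c , u) → concatMap (λ { (d , v) → scale (c *ℚ d) (u ⋄ʷ v) }) q }) p

InX⁺ : Poly → Set
InX⁺ p = All (λ { (c , w) → (1 ≤ length w) × All (1 ≤_) w }) p

InBlockSpan : Poly → Set
InBlockSpan f =
  ∃ λ (L : List (ℚ × Poly × Poly)) →
    All (λ { (c , u , v) → InX⁺ u × InX⁺ v }) L ×
    (f ≈ concatMap (λ { (c , u , v) → scale c (u ⋄ v) }) L)

-- The symmetric group 𝔖_m, as the list of all bijections Fin m → Fin m
-- (each given by its table of values σ(0),…,σ(m−1)).

allMaps : (m k : ℕ) → List (Vec (Fin k) m)
allMaps zero    k = [] ∷ []
allMaps (suc m) k = cartesianProductWith _∷_ (allFin k) (allMaps m k)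

-- no repeated value (for a self-map of a finite set: injective ⇔ bijective)
noDup : ∀ {k} → List (Fin k) → Bool
noDup []       = true
noDup (x ∷ xs) = not (any (λ y → does (x ≟F y)) xs) ∧ noDup xs

Sym : (m : ℕ) → List (Vec (Fin m) m)
Sym m = filter (λ σ → noDup (toList σ) Data.Bool.≟ true) (allMaps m m)
  where import Data.Bool

inversions : ∀ {k} → List (Fin k) → ℕ
inversions []       = 0
inversions (x ∷ xs) = length (filter (λ y → Data.Bool._≟_ (toℕ y <ᵇ toℕ x) true) xs) + inversions xs
  where import Data.Bool

minusOnePow : ℕ → ℚ
minusOnePow zero    = 1ℚ
minusOnePow (suc k) = - minusOnePow k

sgn : ∀ {m} → Vec (Fin m) m → ℚ
sgn σ = minusOnePow (inversions (toList σ))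

interleave : ∀ {n} → (Fin (suc n) → ℕ) → (Fin n → ℕ) → Word
interleave {zero}  c b = c zero ∷ []
interleave {suc n} c b = c zero ∷ b zero ∷ interleave (c ∘ suc) (b ∘ suc)

altSum : (n : ℕ) → (Fin (suc n) → ℕ) → (Fin n → ℕ) → Poly
altSum n a b = map (λ σ → (sgn σ , interleave (a ∘ lookup σ) b)) (Sym (suc n))

-- Write A(c; b) for the alternating sum with moving letters c = (c₀, …, cₙ) and fixed letters
-- b = (b₁, …, bₙ). Expanding along the first letter,
--   A(c; b₁b′) = Σⱼ (−1)ʲ x_{cⱼ} x_{b₁} A(c ∖ cⱼ; b′).
-- The recursion of ⋄ gives x_y ⋄ x_e Q = x_y x_e Q + x_e (x_y ⋄ Q) − s_{y+e}(Q), so it suffices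
-- that the alternating sums over y of x_y ⋄ A(c ∖ y; b′) and of s_{y+e}(A(c ∖ y; b′)) vanish.
-- Expanding A(c ∖ y; b′) once more turns both into double alternating sums Σ ε(y, z) F(y, z), which
-- vanish when F is symmetric in y and z: s_{y+e}(x_z W) = x_{y+z+e} W is, and x_y ⋄ x_z W is
-- x_y x_z W + x_z x_y W − s_{y+z}(W) plus terms whose alternating sums vanish by induction on b.
-- Hence A(c; b) = Σⱼ (−1)ʲ x_{cⱼ} ⋄ x_{b₁} A(c ∖ cⱼ; b′), which lies in 𝔛⁺ ⋄ 𝔛⁺ as n ≥ 1.

module Submission where

open import Defs
open import Algebra.Bundles using (AbelianGroup; CommutativeMonoid)
import Algebra.Properties.CommutativeSemigroup
open import Data.Bool using (Bool; true; false; not; _∧_; _∨_; if_then_else_)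
import Data.Bool as Bool
open import Data.Bool.ListAction using (any)
open import Data.Empty using (⊥-elim)
open import Data.Fin using (Fin; zero; suc; toℕ; punchIn; punchOut)
import Data.Fin.Properties as Fin
open import Data.List using (List; []; _∷_; _++_; map; concatMap; filter; length; tabulate; allFin; cartesianProductWith)
import Data.List.Properties as List
open import Data.List.Relation.Unary.All using (All; []; _∷_)
import Data.List.Relation.Unary.All as All
import Data.List.Relation.Unary.All.Properties as All
open import Data.List.Relation.Unary.Unique.Propositional using (Unique; []; _∷_)
import Data.List.Relation.Unary.Unique.Propositional.Properties as Unique
open import Data.Nat using (ℕ; zero; suc; _+_; _≤_; _≡ᵇ_; _<ᵇ_; z≤n; s≤s)
import Data.Nat.Properties as ℕ
open import Data.Product using (_×_; _,_; ∃)
open import Data.Rational using (ℚ; 0ℚ; 1ℚ; -_) renaming (_+_ to _+ℚ_; _*_ to _*ℚ_)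
import Data.Rational.Properties as ℚ
open import Algebra.Properties.Ring ℚ.+-*-ring using (-1*x≈-x)
open import Data.Vec using (Vec; toList; lookup)
import Data.Vec as Vec
import Data.Vec.Properties as Vec
open import Function using (_∘_; id)
open import Relation.Binary.Bundles using (Setoid)
import Relation.Binary.Reasoning.Setoid
open import Relation.Binary.PropositionalEquality
open import Relation.Nullary.Decidable using (does; yes; no)

module ℕ+ = Algebra.Properties.CommutativeSemigroup ℕ.+-commutativeSemigroup
module ℚ* = Algebra.Properties.CommutativeSemigroup (CommutativeMonoid.commutativeSemigroup ℚ.*-1-commutativeMonoid)

coeff-++ : ∀ p q w → coeff (p ++ q) w ≡ coeff p w +ℚ coeff q w
coeff-++ []            q w = sym (ℚ.+-identityˡ _)
coeff-++ ((c , u) ∷ p) q w with does (u ≟W w)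
... | true  = trans (cong (c +ℚ_) (coeff-++ p q w)) (sym (ℚ.+-assoc c _ _))
... | false = coeff-++ p q w

coeff-scale : ∀ k p w → coeff (scale k p) w ≡ k *ℚ coeff p w
coeff-scale k []            w = sym (ℚ.*-zeroʳ k)
coeff-scale k ((c , u) ∷ p) w with does (u ≟W w)
... | true  = trans (cong (k *ℚ c +ℚ_) (coeff-scale k p w)) (sym (ℚ.*-distribˡ-+ k c _))
... | false = coeff-scale k p w

coeff-prefix-[] : ∀ x p → coeff (prefix x p) [] ≡ 0ℚ
coeff-prefix-[] x []      = refl
coeff-prefix-[] x (_ ∷ p) = coeff-prefix-[] x p

coeff-prefix-∷ : ∀ x p z w → coeff (prefix x p) (z ∷ w) ≡ (if x ≡ᵇ z then coeff p w else 0ℚ)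
coeff-prefix-∷ x p z w with x ≡ᵇ z in x≡ᵇz
... | true  = matching p
  where
  matching : ∀ p → coeff (prefix x p) (z ∷ w) ≡ coeff p w
  matching []            = refl
  matching ((c , u) ∷ p) rewrite x≡ᵇz with does (u ≟W w)
  ... | true  = cong (c +ℚ_) (matching p)
  ... | false = matching p
... | false = mismatching p
  where
  mismatching : ∀ p → coeff (prefix x p) (z ∷ w) ≡ 0ℚ
  mismatching []      = refl
  mismatching (_ ∷ p) rewrite x≡ᵇz = mismatching p

-- A record around `_≈_`, so that both sides can be inferred from a proof.
infix 4 _≋_
record _≋_ (p q : Poly) : Set where
  constructor coeffwise
  field coeff-≡ : p ≈ q
open _≋_

≡⇒≋ : ∀ {p q} → p ≡ q → p ≋ q
≡⇒≋ refl = coeffwise λ _ → refl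

≋-setoid : Setoid _ _
≋-setoid = record
  { Carrier       = Poly
  ; _≈_           = _≋_
  ; isEquivalence = record
    { refl  = coeffwise λ _ → refl
    ; sym   = λ e → coeffwise λ w → sym (coeff-≡ e w)
    ; trans = λ e f → coeffwise λ w → trans (coeff-≡ e w) (coeff-≡ f w)
    }
  }

open Setoid ≋-setoid using () renaming (refl to ≋-refl; sym to ≋-sym; trans to ≋-trans)

neg : Poly → Poly
neg = scale (- 1ℚ)

coeff-neg : ∀ p w → coeff (neg p) w ≡ - coeff p w
coeff-neg p w = trans (coeff-scale (- 1ℚ) p w) (-1*x≈-x _)

++-cong : ∀ {p p′ q q′} → p ≋ p′ → q ≋ q′ → p ++ q ≋ p′ ++ q′
++-cong {p} {p′} {q} {q′} e f = coeffwise λ w → begin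
  coeff (p ++ q) w          ≡⟨ coeff-++ p q w ⟩
  coeff p w +ℚ coeff q w    ≡⟨ cong₂ _+ℚ_ (coeff-≡ e w) (coeff-≡ f w) ⟩
  coeff p′ w +ℚ coeff q′ w  ≡⟨ coeff-++ p′ q′ w ⟨
  coeff (p′ ++ q′) w        ∎
  where open ≡-Reasoning

++-congˡ : ∀ p {q q′} → q ≋ q′ → p ++ q ≋ p ++ q′
++-congˡ p = ++-cong (≋-refl {p})

++-congʳ : ∀ {p p′} q → p ≋ p′ → p ++ q ≋ p′ ++ q
++-congʳ q e = ++-cong e (≋-refl {q})

scale-cong : ∀ k {p q} → p ≋ q → scale k p ≋ scale k q
scale-cong k {p} {q} e = coeffwise λ w →
  trans (coeff-scale k p w) (trans (cong (k *ℚ_) (coeff-≡ e w)) (sym (coeff-scale k q w)))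

neg-cong : ∀ {p q} → p ≋ q → neg p ≋ neg q
neg-cong = scale-cong (- 1ℚ)

prefix-cong : ∀ x {p q} → p ≋ q → prefix x p ≋ prefix x q
prefix-cong x {p} {q} e = coeffwise λ where
  []      → trans (coeff-prefix-[] x p) (sym (coeff-prefix-[] x q))
  (z ∷ w) → trans (coeff-prefix-∷ x p z w) (trans (cong (if x ≡ᵇ z then_else 0ℚ) (coeff-≡ e w))
                                                  (sym (coeff-prefix-∷ x q z w)))

poly-abelianGroup : AbelianGroup _ _
poly-abelianGroup = record
  { Carrier        = Poly
  ; _≈_            = _≋_
  ; _∙_            = _++_
  ; ε              = []
  ; _⁻¹            = neg
  ; isAbelianGroup = record
    { isGroup = record
      { isMonoid = record
        { isSemigroup = record
          { isMagma = record { isEquivalence = Setoid.isEquivalence ≋-setoid ; ∙-cong = ++-cong }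
          ; assoc   = λ p q r → ≡⇒≋ (List.++-assoc p q r)
          }
        ; identity = (λ _ → ≋-refl) , (λ p → ≡⇒≋ (List.++-identityʳ p))
        }
      ; inverse = (λ p → coeffwise λ w → trans (coeff-++ (neg p) p w)
                    (trans (cong (_+ℚ coeff p w) (coeff-neg p w)) (ℚ.+-inverseˡ (coeff p w))))
                , (λ p → coeffwise λ w → trans (coeff-++ p (neg p) w)
                    (trans (cong (coeff p w +ℚ_) (coeff-neg p w)) (ℚ.+-inverseʳ (coeff p w))))
      ; ⁻¹-cong = neg-cong
      }
    ; comm = λ p q → coeffwise λ w →
        trans (coeff-++ p q w) (trans (ℚ.+-comm (coeff p w) (coeff q w)) (sym (coeff-++ q p w)))
    }
  }

open AbelianGroup poly-abelianGroup using (inverseʳ; identityʳ; comm; assoc)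
open import Algebra.Properties.AbelianGroup poly-abelianGroup
  using (⁻¹-∙-comm; ⁻¹-involutive)
open import Algebra.Properties.CommutativeSemigroup (AbelianGroup.commutativeSemigroup poly-abelianGroup)
  using (interchange; x∙yz≈y∙xz; xy∙z≈xz∙y)

module ≋-Reasoning = Relation.Binary.Reasoning.Setoid ≋-setoid

scale-scale : ∀ k l p → scale k (scale l p) ≡ scale (k *ℚ l) p
scale-scale k l []            = refl
scale-scale k l ((c , w) ∷ p) = cong₂ _∷_ (cong (_, w) (sym (ℚ.*-assoc k l c))) (scale-scale k l p)

scale-1 : ∀ p → scale 1ℚ p ≡ p
scale-1 []            = refl
scale-1 ((c , w) ∷ p) = cong₂ _∷_ (cong (_, w) (ℚ.*-identityˡ c)) (scale-1 p)

neg-scale : ∀ c p → neg (scale c p) ≡ scale (- c) p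
neg-scale c p = trans (scale-scale (- 1ℚ) c p) (cong (λ m → scale m p) (-1*x≈-x c))

record Linear (L : Poly → Poly) : Set where
  field
    []-homo    : L [] ≋ []
    ++-homo    : ∀ p q → L (p ++ q) ≋ L p ++ L q
    scale-homo : ∀ k p → L (scale k p) ≋ scale k (L p)

  neg-homo : ∀ p → L (neg p) ≋ neg (L p)
  neg-homo = scale-homo (- 1ℚ)

open Linear

scale-linear : ∀ k → Linear (scale k)
scale-linear k = record
  { []-homo    = ≋-refl
  ; ++-homo    = λ p q → ≡⇒≋ (List.map-++ _ p q)
  ; scale-homo = λ l p → ≡⇒≋ (begin
      scale k (scale l p) ≡⟨ scale-scale k l p ⟩
      scale (k *ℚ l) p    ≡⟨ cong (λ m → scale m p) (ℚ.*-comm k l) ⟩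
      scale (l *ℚ k) p    ≡⟨ scale-scale l k p ⟨
      scale l (scale k p) ∎)
  }
  where open ≡-Reasoning

neg-linear : Linear neg
neg-linear = scale-linear (- 1ℚ)

prefix-scale : ∀ x k p → prefix x (scale k p) ≡ scale k (prefix x p)
prefix-scale x k []      = refl
prefix-scale x k (_ ∷ p) = cong (_ ∷_) (prefix-scale x k p)

prefix-linear : ∀ x → Linear (prefix x)
prefix-linear x = record
  { []-homo    = ≋-refl
  ; ++-homo    = λ p q → ≡⇒≋ (List.map-++ _ p q)
  ; scale-homo = λ k p → ≡⇒≋ (prefix-scale x k p)
  }

s-linear : ∀ k → Linear (s k)
s-linear k = record
  { []-homo    = ≋-refl
  ; ++-homo    = λ p q → ≡⇒≋ (List.concatMap-++ _ p q)
  ; scale-homo = λ l p → ≡⇒≋ (s-scale l p)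
  }
  where
  s-scale : ∀ l p → s k (scale l p) ≡ scale l (s k p)
  s-scale l []                = refl
  s-scale l ((c , [])    ∷ p) = s-scale l p
  s-scale l ((c , i ∷ w) ∷ p) = cong (_ ∷_) (s-scale l p)

++-linear : ∀ {L M} → Linear L → Linear M → Linear (λ p → L p ++ M p)
++-linear {L} {M} lin-L lin-M = record
  { []-homo    = ++-cong ([]-homo lin-L) ([]-homo lin-M)
  ; ++-homo    = λ p q → ≋-trans (++-cong (++-homo lin-L p q) (++-homo lin-M p q))
                                 (interchange (L p) (L q) (M p) (M q))
  ; scale-homo = λ k p → ≋-trans (++-cong (scale-homo lin-L k p) (scale-homo lin-M k p))
                                 (≡⇒≋ (sym (List.map-++ _ (L p) (M p))))
  }

concatMap-linear : ∀ {f : ℚ × Word → Poly} → (∀ k c w → f (k *ℚ c , w) ≋ scale k (f (c , w))) →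
                   Linear (concatMap f)
concatMap-linear {f} f-homo = record
  { []-homo    = ≋-refl
  ; ++-homo    = λ p q → ≡⇒≋ (List.concatMap-++ f p q)
  ; scale-homo = scale-homo′
  }
  where
  scale-homo′ : ∀ k p → concatMap f (scale k p) ≋ scale k (concatMap f p)
  scale-homo′ k []            = ≋-refl
  scale-homo′ k ((c , w) ∷ p) = ≋-trans (++-cong (f-homo k c w) (scale-homo′ k p))
                                        (≡⇒≋ (sym (List.map-++ _ (f (c , w)) (concatMap f p))))

⋄-linearʳ : ∀ p → Linear (p ⋄_)
⋄-linearʳ []            = record { []-homo = ≋-refl ; ++-homo = λ _ _ → ≋-refl ; scale-homo = λ _ _ → ≋-refl }
⋄-linearʳ ((c , u) ∷ p) = ++-linear (concatMap-linear λ k d v → ≡⇒≋ (begin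
    scale (c *ℚ (k *ℚ d)) (u ⋄ʷ v)  ≡⟨ cong (λ m → scale m (u ⋄ʷ v)) (ℚ*.x∙yz≈y∙xz c k d) ⟩
    scale (k *ℚ (c *ℚ d)) (u ⋄ʷ v)  ≡⟨ scale-scale k (c *ℚ d) (u ⋄ʷ v) ⟨
    scale k (scale (c *ℚ d) (u ⋄ʷ v)) ∎))
  (⋄-linearʳ p)
  where
  open ≡-Reasoning

∘-linear : ∀ {L M} → (∀ {p q} → p ≋ q → L p ≋ L q) → Linear L → Linear M → Linear (L ∘ M)
∘-linear {L} {M} L-cong lin-L lin-M = record
  { []-homo    = ≋-trans (L-cong ([]-homo lin-M)) ([]-homo lin-L)
  ; ++-homo    = λ p q → ≋-trans (L-cong (++-homo lin-M p q)) (++-homo lin-L (M p) (M q))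
  ; scale-homo = λ k p → ≋-trans (L-cong (scale-homo lin-M k p)) (scale-homo lin-L k (M p))
  }

∘prefix-linear : ∀ {L} x → Linear L → Linear (L ∘ prefix x)
∘prefix-linear {L} x lin-L = record
  { []-homo    = []-homo lin-L
  ; ++-homo    = λ p q → subst (λ r → L r ≋ L (prefix x p) ++ L (prefix x q))
                               (sym (List.map-++ _ p q)) (++-homo lin-L (prefix x p) (prefix x q))
  ; scale-homo = λ k p → subst (λ r → L r ≋ scale k (L (prefix x p)))
                               (sym (prefix-scale x k p)) (scale-homo lin-L k (prefix x p))
  }

word : Word → Poly
word w = (1ℚ , w) ∷ []

letter : ℕ → Poly
letter y = word (y ∷ [])

linear-ext : ∀ {L M} → Linear L → Linear M → (∀ w → L (word w) ≋ M (word w)) → ∀ p → L p ≋ M p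
linear-ext lin-L lin-M agree []              = ≋-trans ([]-homo lin-L) (≋-sym ([]-homo lin-M))
linear-ext {L} {M} lin-L lin-M agree ((c , w) ∷ p) = begin
  L ((c , w) ∷ p)          ≈⟨ ++-homo lin-L ((c , w) ∷ []) p ⟩
  L ((c , w) ∷ []) ++ L p  ≈⟨ ++-cong on-term (linear-ext lin-L lin-M agree p) ⟩
  M ((c , w) ∷ []) ++ M p  ≈⟨ ++-homo lin-M ((c , w) ∷ []) p ⟨
  M ((c , w) ∷ p)          ∎
  where
  open ≋-Reasoning
  scaled-word : scale c (word w) ≡ (c , w) ∷ []
  scaled-word = cong (λ m → (m , w) ∷ []) (ℚ.*-identityʳ c)
  on-term : L ((c , w) ∷ []) ≋ M ((c , w) ∷ [])
  on-term = begin
    L ((c , w) ∷ [])       ≡⟨ cong L scaled-word ⟨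
    L (scale c (word w))   ≈⟨ scale-homo lin-L c (word w) ⟩
    scale c (L (word w))   ≈⟨ scale-cong c (agree w) ⟩
    scale c (M (word w))   ≈⟨ scale-homo lin-M c (word w) ⟨
    M (scale c (word w))   ≡⟨ cong M scaled-word ⟩
    M ((c , w) ∷ [])       ∎

word-⋄ : ∀ u v → word u ⋄ word v ≋ u ⋄ʷ v
word-⋄ u v = ≡⇒≋ (begin
  (scale (1ℚ *ℚ 1ℚ) (u ⋄ʷ v) ++ []) ++ []  ≡⟨ List.++-identityʳ _ ⟩
  scale (1ℚ *ℚ 1ℚ) (u ⋄ʷ v) ++ []          ≡⟨ List.++-identityʳ _ ⟩
  scale (1ℚ *ℚ 1ℚ) (u ⋄ʷ v)                ≡⟨ scale-1 (u ⋄ʷ v) ⟩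
  u ⋄ʷ v                                   ∎)
  where open ≡-Reasoning

letter⋄letter-comm : ∀ y z → letter y ⋄ letter z ≋ letter z ⋄ letter y
letter⋄letter-comm y z = begin
  letter y ⋄ letter z                     ≈⟨ word-⋄ (y ∷ []) (z ∷ []) ⟩
  word (y ∷ z ∷ []) ++ word (z ∷ y ∷ [])  ≈⟨ comm (word (y ∷ z ∷ [])) (word (z ∷ y ∷ [])) ⟩
  word (z ∷ y ∷ []) ++ word (y ∷ z ∷ [])  ≈⟨ word-⋄ (z ∷ []) (y ∷ []) ⟨
  letter z ⋄ letter y                     ∎
  where open ≋-Reasoning

letter⋄prefix : ∀ y z p →
  letter y ⋄ prefix z p ≋ prefix y (prefix z p) ++ (prefix z (letter y ⋄ p) ++ neg (s (y + z) p))
letter⋄prefix y z = linear-ext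
  (∘prefix-linear z (⋄-linearʳ (letter y)))
  (++-linear (∘prefix-linear z (prefix-linear y))
    (++-linear (∘-linear (prefix-cong z) (prefix-linear z) (⋄-linearʳ (letter y)))
               (∘-linear neg-cong neg-linear (s-linear (y + z)))))
  λ w → begin
    letter y ⋄ prefix z (word w)  ≈⟨ word-⋄ (y ∷ []) (z ∷ w) ⟩
    (y ∷ []) ⋄ʷ (z ∷ w)           ≈⟨ ++-congˡ (word (y ∷ z ∷ w))
                                       (++-congʳ (neg (s (y + z) (word w))) (prefix-cong z (word-⋄ (y ∷ []) w))) ⟨
    prefix y (prefix z (word w)) ++ (prefix z (letter y ⋄ word w) ++ neg (s (y + z) (word w))) ∎
  where open ≋-Reasoning

s-prefix : ∀ k x p → s k (prefix x p) ≡ prefix (x + k) p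
s-prefix k x []      = refl
s-prefix k x (_ ∷ p) = cong (_ ∷_) (s-prefix k x p)

letter⋄prefix² : ∀ y z e q →
  letter y ⋄ prefix z (prefix e q) ≋
    (prefix y (prefix z (prefix e q)) ++ (prefix z (prefix y (prefix e q)) ++ neg (prefix (e + (y + z)) q)))
    ++ (prefix z (prefix e (letter y ⋄ q)) ++ neg (prefix z (s (y + e) q)))
letter⋄prefix² y z e q = begin
  letter y ⋄ prefix z p
    ≈⟨ letter⋄prefix y z p ⟩
  a ++ (prefix z (letter y ⋄ p) ++ neg (s (y + z) p))
    ≈⟨ ++-congˡ a (++-cong (prefix-cong z (letter⋄prefix y e q)) (≡⇒≋ (cong neg (s-prefix (y + z) e q)))) ⟩
  a ++ (prefix z (prefix y p ++ r) ++ w)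
    ≈⟨ ++-congˡ a (++-congʳ w (≋-trans (++-homo (prefix-linear z) (prefix y p) r) (++-congˡ b
         (≋-trans (++-homo (prefix-linear z) (prefix e (letter y ⋄ q)) (neg (s (y + e) q)))
                  (++-congˡ t (neg-homo (prefix-linear z) (s (y + e) q))))))) ⟩
  a ++ ((b ++ (t ++ neg t′)) ++ w)
    ≈⟨ ++-congˡ a (xy∙z≈xz∙y b (t ++ neg t′) w) ⟩
  a ++ ((b ++ w) ++ (t ++ neg t′))
    ≈⟨ assoc a (b ++ w) (t ++ neg t′) ⟨
  (a ++ (b ++ w)) ++ (t ++ neg t′) ∎
  where
  open ≋-Reasoning
  p a b r w t t′ : Poly
  p  = prefix e q
  a  = prefix y (prefix z p)
  b  = prefix z (prefix y p)
  r  = prefix e (letter y ⋄ q) ++ neg (s (y + e) q)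
  w  = neg (prefix (e + (y + z)) q)
  t  = prefix z (prefix e (letter y ⋄ q))
  t′ = prefix z (s (y + e) q)

-- Alternating sums

-- alt f [c₀, …, cₖ] = Σⱼ (−1)ʲ f cⱼ [c₀, …, cⱼ₋₁, cⱼ₊₁, …, cₖ]
alt : (ℕ → List ℕ → Poly) → List ℕ → Poly
alt f []       = []
alt f (x ∷ xs) = f x xs ++ neg (alt (λ y ys → f y (x ∷ ys)) xs)

alt-cong : ∀ {f g} → (∀ y ys → f y ys ≋ g y ys) → ∀ c → alt f c ≋ alt g c
alt-cong f≋g []       = ≋-refl
alt-cong f≋g (x ∷ xs) = ++-cong (f≋g x xs) (neg-cong (alt-cong (λ y ys → f≋g y (x ∷ ys)) xs))

alt-const-[] : ∀ c → alt (λ _ _ → []) c ≋ []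
alt-const-[] []       = ≋-refl
alt-const-[] (x ∷ xs) = neg-cong (alt-const-[] xs)

alt-++ : ∀ f g c → alt (λ y ys → f y ys ++ g y ys) c ≋ alt f c ++ alt g c
alt-++ f g []       = ≋-refl
alt-++ f g (x ∷ xs) = begin
  (f x xs ++ g x xs) ++ neg (alt (λ y ys → f′ y ys ++ g′ y ys) xs)
    ≈⟨ ++-congˡ (f x xs ++ g x xs) (neg-cong (alt-++ f′ g′ xs)) ⟩
  (f x xs ++ g x xs) ++ neg (alt f′ xs ++ alt g′ xs)
    ≈⟨ ++-congˡ (f x xs ++ g x xs) (⁻¹-∙-comm (alt f′ xs) (alt g′ xs)) ⟨
  (f x xs ++ g x xs) ++ (neg (alt f′ xs) ++ neg (alt g′ xs))
    ≈⟨ interchange (f x xs) (g x xs) (neg (alt f′ xs)) (neg (alt g′ xs)) ⟩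
  (f x xs ++ neg (alt f′ xs)) ++ (g x xs ++ neg (alt g′ xs)) ∎
  where
  open ≋-Reasoning
  f′ g′ : ℕ → List ℕ → Poly
  f′ y ys = f y (x ∷ ys)
  g′ y ys = g y (x ∷ ys)

linear-alt : ∀ {L} → Linear L → ∀ f c → L (alt f c) ≋ alt (λ y ys → L (f y ys)) c
linear-alt lin-L f []       = []-homo lin-L
linear-alt {L} lin-L f (x ∷ xs) = begin
  L (f x xs ++ neg (alt f′ xs))       ≈⟨ ++-homo lin-L (f x xs) (neg (alt f′ xs)) ⟩
  L (f x xs) ++ L (neg (alt f′ xs))   ≈⟨ ++-congˡ (L (f x xs)) (neg-homo lin-L (alt f′ xs)) ⟩
  L (f x xs) ++ neg (L (alt f′ xs))   ≈⟨ ++-congˡ (L (f x xs)) (neg-cong (linear-alt lin-L f′ xs)) ⟩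
  L (f x xs) ++ neg (alt (λ y ys → L (f′ y ys)) xs) ∎
  where
  open ≋-Reasoning
  f′ : ℕ → List ℕ → Poly
  f′ y ys = f y (x ∷ ys)

alt² : (ℕ → ℕ → List ℕ → Poly) → List ℕ → Poly
alt² g = alt (λ y ys → alt (g y) ys)

alt²-cong : ∀ {g h} → (∀ y z r → g y z r ≋ h y z r) → ∀ c → alt² g c ≋ alt² h c
alt²-cong g≋h = alt-cong (λ y → alt-cong (g≋h y))

alt²-++ : ∀ g h c → alt² (λ y z r → g y z r ++ h y z r) c ≋ alt² g c ++ alt² h c
alt²-++ g h c = ≋-trans (alt-cong (λ y → alt-++ (g y) (h y)) c) (alt-++ (λ y → alt (g y)) (λ y → alt (h y)) c)

alt²-neg : ∀ g c → alt² (λ y z r → neg (g y z r)) c ≋ neg (alt² g c)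
alt²-neg g c = ≋-sym (≋-trans (linear-alt neg-linear (λ y → alt (g y)) c)
                              (alt-cong (λ y → linear-alt neg-linear (g y)) c))

alt²-∷ : ∀ g x xs →
  alt² g (x ∷ xs) ≋ alt (g x) xs ++ (neg (alt (λ y → g y x) xs) ++ alt² (λ y z r → g y z (x ∷ r)) xs)
alt²-∷ g x xs = ++-congˡ (alt (g x) xs) (begin
  neg (alt (λ y ys → g y x ys ++ neg (alt (λ z zs → g y z (x ∷ zs)) ys)) xs)
    ≈⟨ neg-cong (alt-++ (λ y → g y x) (λ y ys → neg (alt (λ z zs → g y z (x ∷ zs)) ys)) xs) ⟩
  neg (alt (λ y → g y x) xs ++ alt (λ y ys → neg (alt (λ z zs → g y z (x ∷ zs)) ys)) xs)
    ≈⟨ neg-cong (++-congˡ (alt (λ y → g y x) xs)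
                          (≋-sym (linear-alt neg-linear (λ y → alt (λ z zs → g y z (x ∷ zs))) xs))) ⟩
  neg (alt (λ y → g y x) xs ++ neg (alt² (λ y z r → g y z (x ∷ r)) xs))
    ≈⟨ ⁻¹-∙-comm (alt (λ y → g y x) xs) (neg (alt² (λ y z r → g y z (x ∷ r)) xs)) ⟨
  neg (alt (λ y → g y x) xs) ++ neg (neg (alt² (λ y z r → g y z (x ∷ r)) xs))
    ≈⟨ ++-congˡ (neg (alt (λ y → g y x) xs)) (⁻¹-involutive _) ⟩
  neg (alt (λ y → g y x) xs) ++ alt² (λ y z r → g y z (x ∷ r)) xs ∎)
  where open ≋-Reasoning

alt²-swap : ∀ g c → alt² g c ≋ neg (alt² (λ y z → g z y) c)
alt²-swap g []       = ≋-refl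
alt²-swap g (x ∷ xs) = begin
  alt² g (x ∷ xs)
    ≈⟨ alt²-∷ g x xs ⟩
  A ++ (neg B ++ alt² (λ y z r → g y z (x ∷ r)) xs)
    ≈⟨ ++-congˡ A (++-congˡ (neg B) (alt²-swap (λ y z r → g y z (x ∷ r)) xs)) ⟩
  A ++ (neg B ++ neg D)
    ≈⟨ x∙yz≈y∙xz A (neg B) (neg D) ⟩
  neg B ++ (A ++ neg D)
    ≈⟨ ++-congˡ (neg B) (++-congʳ (neg D) (⁻¹-involutive A)) ⟨
  neg B ++ (neg (neg A) ++ neg D)
    ≈⟨ ++-congˡ (neg B) (⁻¹-∙-comm (neg A) D) ⟩
  neg B ++ neg (neg A ++ D)
    ≈⟨ ⁻¹-∙-comm B (neg A ++ D) ⟩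
  neg (B ++ (neg A ++ D))
    ≈⟨ neg-cong (alt²-∷ (λ y z → g z y) x xs) ⟨
  neg (alt² (λ y z → g z y) (x ∷ xs)) ∎
  where
  open ≋-Reasoning
  A B D : Poly
  A = alt (g x) xs
  B = alt (λ y → g y x) xs
  D = alt² (λ y z r → g z y (x ∷ r)) xs

alt²-symmetric : ∀ g → (∀ y z r → g y z r ≋ g z y r) → ∀ c → alt² g c ≋ []
alt²-symmetric g sym-g []       = ≋-refl
alt²-symmetric g sym-g (x ∷ xs) = begin
  alt² g (x ∷ xs)
    ≈⟨ alt²-∷ g x xs ⟩
  alt (g x) xs ++ (neg (alt (λ y → g y x) xs) ++ alt² (λ y z r → g y z (x ∷ r)) xs)
    ≈⟨ ++-congˡ (alt (g x) xs) (++-cong (neg-cong (alt-cong (λ y → sym-g y x) xs))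
                               (alt²-symmetric _ (λ y z r → sym-g y z (x ∷ r)) xs)) ⟩
  alt (g x) xs ++ (neg (alt (g x) xs) ++ [])
    ≈⟨ ++-congˡ (alt (g x) xs) (identityʳ (neg (alt (g x) xs))) ⟩
  alt (g x) xs ++ neg (alt (g x) xs)
    ≈⟨ inverseʳ (alt (g x) xs) ⟩
  [] ∎
  where open ≋-Reasoning

-- altInterleave c b is the alternating sum of the statement with moving letters c and fixed
-- letters b, expanded along its first letter.
altInterleave : List ℕ → List ℕ → Poly
altInterleave c []       = alt (λ y _ → letter y) c
altInterleave c (e ∷ es) = alt (λ y ys → prefix y (prefix e (altInterleave ys es))) c

alt-s-alt-prefix≋[] : ∀ k (T : List ℕ → Poly) c →
                      alt (λ y ys → s (y + k) (alt (λ z zs → prefix z (T zs)) ys)) c ≋ []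
alt-s-alt-prefix≋[] k T c = begin
  alt (λ y ys → s (y + k) (alt (λ z zs → prefix z (T zs)) ys)) c
    ≈⟨ alt-cong (λ y → linear-alt (s-linear (y + k)) (λ z zs → prefix z (T zs))) c ⟩
  alt² (λ y z r → s (y + k) (prefix z (T r))) c
    ≈⟨ alt²-symmetric (λ y z r → s (y + k) (prefix z (T r))) (λ y z r → ≡⇒≋ (shifted-symmetric y z r)) c ⟩
  [] ∎
  where
  open ≋-Reasoning
  shifted-symmetric : ∀ y z r → s (y + k) (prefix z (T r)) ≡ s (z + k) (prefix y (T r))
  shifted-symmetric y z r = trans (s-prefix (y + k) z (T r))
    (trans (cong (λ m → prefix m (T r)) (ℕ+.x∙yz≈y∙xz z y k)) (sym (s-prefix (z + k) y (T r))))

alt-s-altInterleave≋[] : ∀ k bs c → alt (λ y ys → s (y + k) (altInterleave ys bs)) c ≋ []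
alt-s-altInterleave≋[] k []       = alt-s-alt-prefix≋[] k (λ _ → word [])
alt-s-altInterleave≋[] k (e ∷ es) = alt-s-alt-prefix≋[] k (λ zs → prefix e (altInterleave zs es))

alt²-prefix≋[] : ∀ (h : ℕ → List ℕ → Poly) → (∀ r → alt h r ≋ []) →
              ∀ c → alt² (λ y z r → prefix z (h y r)) c ≋ []
alt²-prefix≋[] h alt-h≋[] c = begin
  alt² (λ y z r → prefix z (h y r)) c
    ≈⟨ alt²-swap (λ y z r → prefix z (h y r)) c ⟩
  neg (alt² (λ y z r → prefix y (h z r)) c)
    ≈⟨ neg-cong (alt-cong (λ y → linear-alt (prefix-linear y) h) c) ⟨
  neg (alt (λ y ys → prefix y (alt h ys)) c)
    ≈⟨ neg-cong (alt-cong (λ y ys → prefix-cong y (alt-h≋[] ys)) c) ⟩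
  neg (alt (λ _ _ → []) c)
    ≈⟨ neg-cong (alt-const-[] c) ⟩
  [] ∎
  where open ≋-Reasoning

alt-letter⋄altInterleave≋[] : ∀ bs c → alt (λ y ys → letter y ⋄ altInterleave ys bs) c ≋ []
alt-letter⋄altInterleave≋[] [] c = begin
  alt (λ y ys → letter y ⋄ alt (λ z _ → letter z) ys) c
    ≈⟨ alt-cong (λ y → linear-alt (⋄-linearʳ (letter y)) (λ z _ → letter z)) c ⟩
  alt² (λ y z _ → letter y ⋄ letter z) c
    ≈⟨ alt²-symmetric (λ y z _ → letter y ⋄ letter z) (λ y z _ → letter⋄letter-comm y z) c ⟩
  [] ∎
  where open ≋-Reasoning
-- S is the part of x_y ⋄ x_z x_e Q that is symmetric in y and z; the alternating sums over y
-- of X and Y vanish by induction and by alt-s-altInterleave≋[].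
alt-letter⋄altInterleave≋[] (e ∷ es) c = begin
  alt (λ y ys → letter y ⋄ altInterleave ys (e ∷ es)) c
    ≈⟨ alt-cong (λ y → linear-alt (⋄-linearʳ (letter y)) (λ z zs → prefix z (prefix e (Q zs)))) c ⟩
  alt² (λ y z r → letter y ⋄ prefix z (prefix e (Q r))) c
    ≈⟨ alt²-cong (λ y z r → letter⋄prefix² y z e (Q r)) c ⟩
  alt² (λ y z r → S y z r ++ (X y z r ++ neg (Y y z r))) c
    ≈⟨ ≋-trans (alt²-++ S _ c) (++-congˡ (alt² S c) (alt²-++ X (λ y z r → neg (Y y z r)) c)) ⟩
  alt² S c ++ (alt² X c ++ alt² (λ y z r → neg (Y y z r)) c)
    ≈⟨ ++-cong (alt²-symmetric S S-symmetric c) (++-cong X-vanishes (≋-trans (alt²-neg Y c) (neg-cong Y-vanishes))) ⟩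
  [] ++ ([] ++ neg []) ∎
  where
  open ≋-Reasoning
  Q : List ℕ → Poly
  Q r = altInterleave r es
  S X Y : ℕ → ℕ → List ℕ → Poly
  S y z r = prefix y (prefix z (prefix e (Q r))) ++ (prefix z (prefix y (prefix e (Q r))) ++ neg (prefix (e + (y + z)) (Q r)))
  X y z r = prefix z (prefix e (letter y ⋄ Q r))
  Y y z r = prefix z (s (y + e) (Q r))

  S-symmetric : ∀ y z r → S y z r ≋ S z y r
  S-symmetric y z r = ≋-trans (x∙yz≈y∙xz yz zy (neg (prefix (e + (y + z)) (Q r))))
                               (≡⇒≋ (cong (λ m → zy ++ (yz ++ neg (prefix (e + m) (Q r)))) (ℕ.+-comm y z)))
    where
    yz zy : Poly
    yz = prefix y (prefix z (prefix e (Q r)))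
    zy = prefix z (prefix y (prefix e (Q r)))

  X-vanishes : alt² X c ≋ []
  X-vanishes = alt²-prefix≋[] (λ y r → prefix e (letter y ⋄ Q r))
    (λ r → ≋-trans (≋-sym (linear-alt (prefix-linear e) (λ y ys → letter y ⋄ Q ys) r))
                   (prefix-cong e (alt-letter⋄altInterleave≋[] es r)))
    c

  Y-vanishes : alt² Y c ≋ []
  Y-vanishes = alt²-prefix≋[] (λ y r → s (y + e) (Q r)) (alt-s-altInterleave≋[] e es) c

altInterleave≋alt-letter⋄ : ∀ e es c →
  altInterleave c (e ∷ es) ≋ alt (λ y ys → letter y ⋄ prefix e (altInterleave ys es)) c
altInterleave≋alt-letter⋄ e es c = ≋-sym (begin
  alt (λ y ys → letter y ⋄ prefix e (Q ys)) c
    ≈⟨ alt-cong (λ y ys → letter⋄prefix y e (Q ys)) c ⟩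
  alt (λ y ys → A y ys ++ (prefix e (letter y ⋄ Q ys) ++ neg (s (y + e) (Q ys)))) c
    ≈⟨ alt-++ A _ c ⟩
  alt A c ++ alt (λ y ys → prefix e (letter y ⋄ Q ys) ++ neg (s (y + e) (Q ys))) c
    ≈⟨ ++-congˡ (alt A c) (alt-++ (λ y ys → prefix e (letter y ⋄ Q ys)) _ c) ⟩
  alt A c ++ (alt (λ y ys → prefix e (letter y ⋄ Q ys)) c ++ alt (λ y ys → neg (s (y + e) (Q ys))) c)
    ≈⟨ ++-congˡ (alt A c) (++-cong
         (≋-trans (≋-sym (linear-alt (prefix-linear e) (λ y ys → letter y ⋄ Q ys) c))
                  (prefix-cong e (alt-letter⋄altInterleave≋[] es c)))
         (≋-trans (≋-sym (linear-alt neg-linear (λ y ys → s (y + e) (Q ys)) c))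
                  (neg-cong (alt-s-altInterleave≋[] e es c)))) ⟩
  alt A c ++ ([] ++ neg [])
    ≈⟨ identityʳ (alt A c) ⟩
  altInterleave c (e ∷ es) ∎)
  where
  open ≋-Reasoning
  Q : List ℕ → Poly
  Q ys = altInterleave ys es
  A : ℕ → List ℕ → Poly
  A y ys = prefix y (prefix e (Q ys))

-- The span 𝔛⁺ ⋄ 𝔛⁺

record LinearlyClosed (Q : Poly → Set) : Set where
  field
    []-closed    : Q []
    ++-closed    : ∀ {p q} → Q p → Q q → Q (p ++ q)
    scale-closed : ∀ k {p} → Q p → Q (scale k p)

open LinearlyClosed

alt-closed : ∀ {Q} → LinearlyClosed Q → ∀ {P : ℕ → Set} f {c} → All P c →
             (∀ {y ys} → P y → All P ys → Q (f y ys)) → Q (alt f c)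
alt-closed Q-closed f []           Q-f = []-closed Q-closed
alt-closed Q-closed f (Py ∷ P-ys) Q-f =
  ++-closed Q-closed (Q-f Py P-ys)
    (scale-closed Q-closed (- 1ℚ) (alt-closed Q-closed _ P-ys (λ Py′ P-ys′ → Q-f Py′ (Py ∷ P-ys′))))

blockSum : List (ℚ × Poly × Poly) → Poly
blockSum = concatMap (λ { (c , u , v) → scale c (u ⋄ v) })

blockSum-scale : ∀ k L → blockSum (map (λ { (c , u , v) → (k *ℚ c , u , v) }) L) ≡ scale k (blockSum L)
blockSum-scale k []                = refl
blockSum-scale k ((c , u , v) ∷ L) = trans (cong₂ _++_ (sym (scale-scale k c (u ⋄ v))) (blockSum-scale k L))
                                           (sym (List.map-++ _ (scale c (u ⋄ v)) (blockSum L)))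

InBlockSpan-resp : ∀ {p q} → p ≋ q → InBlockSpan p → InBlockSpan q
InBlockSpan-resp p≋q (L , L-ok , p≈L) = L , L-ok , λ w → trans (sym (coeff-≡ p≋q w)) (p≈L w)

InBlockSpan-++ : ∀ {p q} → InBlockSpan p → InBlockSpan q → InBlockSpan (p ++ q)
InBlockSpan-++ {p} {q} (L , L-ok , p≈L) (L′ , L′-ok , q≈L′) = L ++ L′ , All.++⁺ L-ok L′-ok , λ w → begin
  coeff (p ++ q) w                       ≡⟨ coeff-++ p q w ⟩
  coeff p w +ℚ coeff q w                 ≡⟨ cong₂ _+ℚ_ (p≈L w) (q≈L′ w) ⟩
  coeff (blockSum L) w +ℚ coeff (blockSum L′) w ≡⟨ coeff-++ (blockSum L) (blockSum L′) w ⟨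
  coeff (blockSum L ++ blockSum L′) w    ≡⟨ cong (λ r → coeff r w) (List.concatMap-++ _ L L′) ⟨
  coeff (blockSum (L ++ L′)) w           ∎
  where open ≡-Reasoning

InBlockSpan-scale : ∀ k {p} → InBlockSpan p → InBlockSpan (scale k p)
InBlockSpan-scale k {p} (L , L-ok , p≈L) = map (λ { (c , u , v) → (k *ℚ c , u , v) }) L , All.map⁺ L-ok , λ w → begin
  coeff (scale k p) w            ≡⟨ coeff-scale k p w ⟩
  k *ℚ coeff p w                 ≡⟨ cong (k *ℚ_) (p≈L w) ⟩
  k *ℚ coeff (blockSum L) w      ≡⟨ coeff-scale k (blockSum L) w ⟨
  coeff (scale k (blockSum L)) w ≡⟨ cong (λ r → coeff r w) (blockSum-scale k L) ⟨
  coeff (blockSum (map (λ { (c , u , v) → (k *ℚ c , u , v) }) L)) w ∎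
  where open ≡-Reasoning

InBlockSpan-closed : LinearlyClosed InBlockSpan
InBlockSpan-closed = record
  { []-closed    = [] , [] , λ _ → refl
  ; ++-closed    = λ {p} {q} → InBlockSpan-++ {p} {q}
  ; scale-closed = λ k {p} → InBlockSpan-scale k {p}
  }

InBlockSpan-⋄ : ∀ {u v} → InX⁺ u → InX⁺ v → InBlockSpan (u ⋄ v)
InBlockSpan-⋄ {u} {v} u∈X⁺ v∈X⁺ = (1ℚ , u , v) ∷ [] , (u∈X⁺ , v∈X⁺) ∷ [] ,
  λ w → cong (λ r → coeff r w) (sym (trans (List.++-identityʳ (scale 1ℚ (u ⋄ v))) (scale-1 (u ⋄ v))))

AllLetters : (ℕ → Set) → Poly → Set
AllLetters P = All (λ { (_ , w) → All P w })

AllLetters-closed : ∀ P → LinearlyClosed (AllLetters P)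
AllLetters-closed P = record
  { []-closed    = []
  ; ++-closed    = All.++⁺
  ; scale-closed = λ k → All.map⁺
  }

AllLetters-prefix : ∀ {P : ℕ → Set} {x p} → P x → AllLetters P p → AllLetters P (prefix x p)
AllLetters-prefix Px = All.map⁺ ∘ All.map (Px ∷_)

AllLetters-altInterleave : ∀ {P : ℕ → Set} {c} bs → All P c → All P bs → AllLetters P (altInterleave c bs)
AllLetters-altInterleave {P} [] P-c [] = alt-closed (AllLetters-closed P) _ P-c (λ Py _ → (Py ∷ []) ∷ [])
AllLetters-altInterleave {P} (e ∷ es) P-c (Pe ∷ P-es) = alt-closed (AllLetters-closed P) _ P-c
  (λ Py P-ys → AllLetters-prefix Py (AllLetters-prefix Pe (AllLetters-altInterleave es P-ys P-es)))

InX⁺-prefix : ∀ {x p} → 1 ≤ x → AllLetters (1 ≤_) p → InX⁺ (prefix x p)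
InX⁺-prefix x≥1 = All.map⁺ ∘ All.map (λ w≥1 → s≤s z≤n , x≥1 ∷ w≥1)


-- Signs of permutations

bit : Bool → ℕ
bit b = if b then 1 else 0

-- In the form used by `inversions`.
count : ∀ {A : Set} → (A → Bool) → List A → ℕ
count p xs = length (filter (λ x → p x Bool.≟ true) xs)

count-∷ : ∀ {A : Set} (p : A → Bool) x xs → count p (x ∷ xs) ≡ bit (p x) + count p xs
count-∷ p x xs with p x
... | true  = refl
... | false = refl

count-map : ∀ {A B : Set} (p : B → Bool) (f : A → B) xs → count p (map f xs) ≡ count (p ∘ f) xs
count-map p f []       = refl
count-map p f (x ∷ xs) with p (f x)
... | true  = cong suc (count-map p f xs)
... | false = count-map p f xs

count-cong : ∀ {A : Set} {p q : A → Bool} → (∀ x → p x ≡ q x) → ∀ xs → count p xs ≡ count q xs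
count-cong p≗q []       = refl
count-cong {p = p} {q} p≗q (x ∷ xs) with p x | q x | p≗q x
... | true  | .true  | refl = cong suc (count-cong p≗q xs)
... | false | .false | refl = count-cong p≗q xs

count-complement : ∀ {A : Set} (p : A → Bool) xs → count p xs + count (not ∘ p) xs ≡ length xs
count-complement p []       = refl
count-complement p (x ∷ xs) with p x
... | true  = cong suc (count-complement p xs)
... | false = trans (ℕ.+-suc _ _) (cong suc (count-complement p xs))

allFin-suc : ∀ K → allFin (suc K) ≡ zero ∷ map suc (allFin K)
allFin-suc K = cong (zero ∷_) (sym (List.map-tabulate id suc))

count-allFin-suc : ∀ {K} (p : Fin (suc K) → Bool) →
                   count p (allFin (suc K)) ≡ bit (p zero) + count (p ∘ suc) (allFin K)
count-allFin-suc {K} p = begin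
  count p (allFin (suc K))                          ≡⟨ cong (count p) (allFin-suc K) ⟩
  count p (zero ∷ map suc (allFin K))               ≡⟨ count-∷ p zero (map suc (allFin K)) ⟩
  bit (p zero) + count p (map suc (allFin K)) ≡⟨ cong (bit (p zero) +_) (count-map p suc (allFin K)) ⟩
  bit (p zero) + count (p ∘ suc) (allFin K) ∎
  where open ≡-Reasoning

count-allFin-punchIn : ∀ {K} (p : Fin (suc K) → Bool) j →
                       count p (allFin (suc K)) ≡ bit (p j) + count (p ∘ punchIn j) (allFin K)
count-allFin-punchIn p zero = count-allFin-suc p
count-allFin-punchIn {suc K} p (suc j) = begin
  count p (allFin (suc (suc K)))
    ≡⟨ count-allFin-suc p ⟩
  bit (p zero) + count (p ∘ suc) (allFin (suc K))
    ≡⟨ cong (bit (p zero) +_) (count-allFin-punchIn (p ∘ suc) j) ⟩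
  bit (p zero) + (bit (p (suc j)) + count (p ∘ suc ∘ punchIn j) (allFin K))
    ≡⟨ ℕ+.x∙yz≈y∙xz (bit (p zero)) (bit (p (suc j))) _ ⟩
  bit (p (suc j)) + (bit (p zero) + count (p ∘ suc ∘ punchIn j) (allFin K))
    ≡⟨ cong (bit (p (suc j)) +_) (count-allFin-suc {K} (p ∘ punchIn (suc j))) ⟨
  bit (p (suc j)) + count (p ∘ punchIn (suc j)) (allFin (suc K)) ∎
  where
  open ≡-Reasoning

count-<ᵇ-allFin : ∀ {K} k → k ≤ K → count (λ y → toℕ y <ᵇ k) (allFin K) ≡ k
count-<ᵇ-allFin {zero}  zero    z≤n       = refl
count-<ᵇ-allFin {suc K} zero    _         =
  trans (count-allFin-suc {K} (λ y → toℕ y <ᵇ zero)) (count-<ᵇ-allFin {K} zero z≤n)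
count-<ᵇ-allFin {suc K} (suc k) (s≤s k≤K) =
  trans (count-allFin-suc {K} (λ y → toℕ y <ᵇ suc k)) (cong suc (count-<ᵇ-allFin {K} k k≤K))

all≢⇒map-punchIn : ∀ {K} (x : Fin (suc K)) xs → All (x ≢_) xs → ∃ λ ys → map (punchIn x) ys ≡ xs
all≢⇒map-punchIn x []       []           = [] , refl
all≢⇒map-punchIn x (y ∷ xs) (x≢y ∷ x≢xs) with all≢⇒map-punchIn x xs x≢xs
... | ys , refl = punchOut x≢y ∷ ys , cong (_∷ map (punchIn x) ys) (Fin.punchIn-punchOut x≢y)

count-unique-≤ : ∀ {K} (p : Fin K → Bool) xs → Unique xs → count p xs ≤ count p (allFin K)
count-unique-≤ p [] _ = z≤n
count-unique-≤ {suc K} p (x ∷ xs) (x≢xs ∷ xs-unique) with all≢⇒map-punchIn x xs x≢xs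
... | ys , refl = begin
  count p (x ∷ map (punchIn x) ys)                          ≡⟨ count-∷ p x (map (punchIn x) ys) ⟩
  bit (p x) + count p (map (punchIn x) ys)     ≡⟨ cong (_ +_) (count-map p (punchIn x) ys) ⟩
  bit (p x) + count (p ∘ punchIn x) ys         ≤⟨ ℕ.+-monoʳ-≤ _ ys-bound ⟩
  bit (p x) + count (p ∘ punchIn x) (allFin K) ≡⟨ count-allFin-punchIn p x ⟨
  count p (allFin (suc K))                                  ∎
  where
  open ℕ.≤-Reasoning
  ys-bound : count (p ∘ punchIn x) ys ≤ count (p ∘ punchIn x) (allFin K)
  ys-bound = count-unique-≤ (p ∘ punchIn x) ys (Unique.map⁻ xs-unique)

count-unique : ∀ {K} (p : Fin K → Bool) xs → Unique xs → length xs ≡ K → count p xs ≡ count p (allFin K)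
count-unique {K} p xs xs-unique length≡K = ℕ.≤-antisym (count-unique-≤ p xs xs-unique) (ℕ.+-cancelʳ-≤ _ _ _ (begin
  count p (allFin K) + count (not ∘ p) (allFin K) ≡⟨ count-complement p (allFin K) ⟩
  length (allFin K)                               ≡⟨ List.length-tabulate id ⟩
  K                                               ≡⟨ length≡K ⟨
  length xs                                       ≡⟨ count-complement p xs ⟨
  count p xs + count (not ∘ p) xs                 ≤⟨ ℕ.+-monoʳ-≤ _ (count-unique-≤ (not ∘ p) xs xs-unique) ⟩
  count p xs + count (not ∘ p) (allFin K)         ∎))
  where open ℕ.≤-Reasoning

fresh : ∀ {K} → Fin K → List (Fin K) → Bool
fresh x xs = not (any (λ y → does (x Fin.≟ y)) xs)

fresh⇒all≢ : ∀ {K} (x : Fin K) xs → fresh x xs ≡ true → All (x ≢_) xs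
fresh⇒all≢ x []       _ = []
fresh⇒all≢ x (y ∷ xs) h with x Fin.≟ y
... | no x≢y = x≢y ∷ fresh⇒all≢ x xs h

noDup⇒unique : ∀ {K} (xs : List (Fin K)) → noDup xs ≡ true → Unique xs
noDup⇒unique []       _ = []
noDup⇒unique (x ∷ xs) h with fresh x xs in x-fresh | noDup xs in xs-noDup
noDup⇒unique (x ∷ xs) refl | true | true = fresh⇒all≢ x xs x-fresh ∷ noDup⇒unique xs xs-noDup

punchIn-<ᵇ-pivot : ∀ {K} (j : Fin (suc K)) y → (toℕ (punchIn j y) <ᵇ toℕ j) ≡ (toℕ y <ᵇ toℕ j)
punchIn-<ᵇ-pivot zero    y       = refl
punchIn-<ᵇ-pivot (suc j) zero    = refl
punchIn-<ᵇ-pivot (suc j) (suc y) = punchIn-<ᵇ-pivot j y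

punchIn-<ᵇ : ∀ {K} (j : Fin (suc K)) x y → (toℕ (punchIn j y) <ᵇ toℕ (punchIn j x)) ≡ (toℕ y <ᵇ toℕ x)
punchIn-<ᵇ zero    x       y       = refl
punchIn-<ᵇ (suc j) zero    zero    = refl
punchIn-<ᵇ (suc j) (suc x) zero    = refl
punchIn-<ᵇ (suc j) zero    (suc y) = refl
punchIn-<ᵇ (suc j) (suc x) (suc y) = punchIn-<ᵇ j x y

inversions-map-punchIn : ∀ {K} (j : Fin (suc K)) xs → inversions (map (punchIn j) xs) ≡ inversions xs
inversions-map-punchIn j []       = refl
inversions-map-punchIn j (x ∷ xs) =
  cong₂ _+_ (trans (count-map _ (punchIn j) xs) (count-cong (punchIn-<ᵇ j x) xs))
            (inversions-map-punchIn j xs)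

minusOnePow-+ : ∀ m n → minusOnePow (m + n) ≡ minusOnePow m *ℚ minusOnePow n
minusOnePow-+ zero    n = sym (ℚ.*-identityˡ _)
minusOnePow-+ (suc m) n = trans (cong -_ (minusOnePow-+ m n)) (ℚ.neg-distribˡ-* (minusOnePow m) (minusOnePow n))

-- As u is a permutation, exactly toℕ j of the entries after j are smaller than j.
sgn-punchIn : ∀ {K} (j : Fin (suc K)) (u : Vec (Fin K) K) → noDup (toList u) ≡ true →
              sgn (j Vec.∷ Vec.map (punchIn j) u) ≡ minusOnePow (toℕ j) *ℚ sgn u
sgn-punchIn {K} j u u-noDup = trans (cong minusOnePow inversions-≡) (minusOnePow-+ (toℕ j) (inversions (toList u)))
  where
  open ≡-Reasoning
  inversions-≡ : inversions (j ∷ toList (Vec.map (punchIn j) u)) ≡ toℕ j + inversions (toList u)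
  inversions-≡ rewrite Vec.toList-map (punchIn j) u = cong₂ _+_
    (begin
      count (λ y → toℕ y <ᵇ toℕ j) (map (punchIn j) (toList u)) ≡⟨ count-map _ (punchIn j) (toList u) ⟩
      count (λ y → toℕ (punchIn j y) <ᵇ toℕ j) (toList u)        ≡⟨ count-cong (punchIn-<ᵇ-pivot j) (toList u) ⟩
      count (λ y → toℕ y <ᵇ toℕ j) (toList u)
        ≡⟨ count-unique _ (toList u) (noDup⇒unique (toList u) u-noDup) (Vec.length-toList u) ⟩
      count (λ y → toℕ y <ᵇ toℕ j) (allFin K)                    ≡⟨ count-<ᵇ-allFin (toℕ j) (Fin.toℕ≤pred[n] j) ⟩
      toℕ j                                                       ∎)
    (inversions-map-punchIn j (toList u))

-- Sums over permutations

ΣFin : ∀ {K} → (Fin K → Poly) → Poly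
ΣFin {zero}  G = []
ΣFin {suc K} G = G zero ++ ΣFin (G ∘ suc)

ΣFin-cong : ∀ {K} {G H : Fin K → Poly} → (∀ i → G i ≋ H i) → ΣFin G ≋ ΣFin H
ΣFin-cong {zero}  G≋H = ≋-refl
ΣFin-cong {suc K} G≋H = ++-cong (G≋H zero) (ΣFin-cong (G≋H ∘ suc))

ΣFin-punchIn : ∀ {K} (G : Fin (suc K) → Poly) j → ΣFin G ≋ G j ++ ΣFin (G ∘ punchIn j)
ΣFin-punchIn G zero            = ≋-refl
ΣFin-punchIn {suc K} G (suc j) = ≋-trans (++-congˡ (G zero) (ΣFin-punchIn (G ∘ suc) j))
                                         (x∙yz≈y∙xz (G zero) (G (suc j)) (ΣFin (G ∘ suc ∘ punchIn j)))

linear-ΣFin : ∀ {L} → Linear L → ∀ {K} (G : Fin K → Poly) → L (ΣFin G) ≋ ΣFin (L ∘ G)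
linear-ΣFin lin-L {zero}  G = []-homo lin-L
linear-ΣFin lin-L {suc K} G = ≋-trans (++-homo lin-L (G zero) (ΣFin (G ∘ suc)))
                                      (++-congˡ _ (linear-ΣFin lin-L (G ∘ suc)))

concatMap-cong : ∀ {A : Set} {F G : A → Poly} → (∀ x → F x ≋ G x) → ∀ l → concatMap F l ≋ concatMap G l
concatMap-cong F≋G []      = ≋-refl
concatMap-cong F≋G (x ∷ l) = ++-cong (F≋G x) (concatMap-cong F≋G l)

map-as-concatMap : ∀ {A B : Set} (f : A → B) xs → map f xs ≡ concatMap (λ x → f x ∷ []) xs
map-as-concatMap f []       = refl
map-as-concatMap f (x ∷ xs) = cong (f x ∷_) (map-as-concatMap f xs)

concatMap-cong-All : ∀ {A : Set} {P : A → Set} {F G : A → Poly} → (∀ {x} → P x → F x ≋ G x) →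
                     ∀ {l} → All P l → concatMap F l ≋ concatMap G l
concatMap-cong-All F≋G []         = ≋-refl
concatMap-cong-All F≋G (px ∷ pxs) = ++-cong (F≋G px) (concatMap-cong-All F≋G pxs)

linear-concatMap : ∀ {A : Set} {L} → Linear L → ∀ (G : A → Poly) l → L (concatMap G l) ≋ concatMap (L ∘ G) l
linear-concatMap lin-L G []      = []-homo lin-L
linear-concatMap lin-L G (x ∷ l) = ≋-trans (++-homo lin-L (G x) (concatMap G l))
                                           (++-congˡ _ (linear-concatMap lin-L G l))

concatMap-tabulate : ∀ {A : Set} {K} (F : A → Poly) (f : Fin K → A) → concatMap F (tabulate f) ≡ ΣFin (F ∘ f)
concatMap-tabulate {K = zero}  F f = refl
concatMap-tabulate {K = suc K} F f = cong (F (f zero) ++_) (concatMap-tabulate F (f ∘ suc))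

concatMap-allMaps-suc : ∀ L K (G : Vec (Fin K) (suc L) → Poly) →
  concatMap G (allMaps (suc L) K) ≡ ΣFin (λ x → concatMap (G ∘ (x Vec.∷_)) (allMaps L K))
concatMap-allMaps-suc L K G =
  trans (cartesian (allFin K)) (concatMap-tabulate (λ x → concatMap (G ∘ (x Vec.∷_)) (allMaps L K)) id)
  where
  cartesian : ∀ xs → concatMap G (cartesianProductWith Vec._∷_ xs (allMaps L K))
                   ≡ concatMap (λ x → concatMap (G ∘ (x Vec.∷_)) (allMaps L K)) xs
  cartesian []       = refl
  cartesian (x ∷ xs) = trans (List.concatMap-++ G (map (x Vec.∷_) (allMaps L K)) _)
                             (cong₂ _++_ (List.concatMap-map G (x Vec.∷_) (allMaps L K)) (cartesian xs))

when : Bool → Poly → Poly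
when b p = if b then p else []

when-∧ : ∀ a b p → when (a ∧ b) p ≡ when a (when b p)
when-∧ true  b p = refl
when-∧ false b p = refl

when-swap : ∀ a b p → when a (when b p) ≡ when b (when a p)
when-swap true  b p = refl
when-swap false true  p = refl
when-swap false false p = refl

concatMap-filter : ∀ {A : Set} (P : A → Bool) (F : A → Poly) l →
  concatMap F (filter (λ x → P x Bool.≟ true) l) ≡ concatMap (λ x → when (P x) (F x)) l
concatMap-filter P F []      = refl
concatMap-filter P F (x ∷ l) with P x
... | true  = cong (F x ++_) (concatMap-filter P F l)
... | false = concatMap-filter P F l

fresh-∷-self : ∀ {K} (j : Fin K) xs → fresh j (j ∷ xs) ≡ false
fresh-∷-self j xs with j Fin.≟ j
... | yes _   = refl
... | no j≢j = ⊥-elim (j≢j refl)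

fresh-∷-punchIn : ∀ {K} (j : Fin (suc K)) x xs → fresh j (punchIn j x ∷ xs) ≡ fresh j xs
fresh-∷-punchIn j x xs with j Fin.≟ punchIn j x
... | yes j≡ = ⊥-elim (Fin.punchInᵢ≢i j x (sym j≡))
... | no _   = refl

fresh-map-punchIn : ∀ {K} (j : Fin (suc K)) x xs → fresh (punchIn j x) (map (punchIn j) xs) ≡ fresh x xs
fresh-map-punchIn j x xs = cong not (any-map xs)
  where
  ≟-punchIn : ∀ y → does (punchIn j x Fin.≟ punchIn j y) ≡ does (x Fin.≟ y)
  ≟-punchIn y with punchIn j x Fin.≟ punchIn j y | x Fin.≟ y
  ... | yes _  | yes _  = refl
  ... | no _   | no _   = refl
  ... | yes eq | no x≢y = ⊥-elim (x≢y (Fin.punchIn-injective j x y eq))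
  ... | no ne  | yes eq = ⊥-elim (ne (cong (punchIn j) eq))
  any-map : ∀ ys → any (λ y → does (punchIn j x Fin.≟ y)) (map (punchIn j) ys) ≡ any (λ y → does (x Fin.≟ y)) ys
  any-map []       = refl
  any-map (y ∷ ys) = cong₂ _∨_ (≟-punchIn y) (any-map ys)

when-fresh-∷-punchIn : ∀ {K} (j : Fin (suc K)) x τ X →
  when (fresh j (punchIn j x ∷ τ) ∧ noDup (punchIn j x ∷ τ)) X
  ≡ when (fresh j τ ∧ noDup τ) (when (fresh (punchIn j x) τ) X)
when-fresh-∷-punchIn j x τ X = begin
  when (fresh j (punchIn j x ∷ τ) ∧ (b ∧ c)) X ≡⟨ cong (λ a → when (a ∧ (b ∧ c)) X) (fresh-∷-punchIn j x τ) ⟩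
  when (a ∧ (b ∧ c)) X                         ≡⟨ when-∧ a (b ∧ c) X ⟩
  when a (when (b ∧ c) X)                      ≡⟨ cong (when a) (trans (when-∧ b c X) (when-swap b c X)) ⟩
  when a (when c (when b X))                   ≡⟨ when-∧ a c (when b X) ⟨
  when (a ∧ c) (when b X)                      ∎
  where
  open ≡-Reasoning
  a b c : Bool
  a = fresh j τ
  b = fresh (punchIn j x) τ
  c = noDup τ

when-noDup-map-punchIn : ∀ {K} (j : Fin (suc K)) x u X →
  when (noDup u) (when (fresh (punchIn j x) (map (punchIn j) u)) X) ≡ when (noDup (x ∷ u)) X
when-noDup-map-punchIn j x u X = begin
  when (noDup u) (when (fresh (punchIn j x) (map (punchIn j) u)) X)
    ≡⟨ cong (λ b → when (noDup u) (when b X)) (fresh-map-punchIn j x u) ⟩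
  when (noDup u) (when (fresh x u) X)
    ≡⟨ when-swap (noDup u) (fresh x u) X ⟩
  when (fresh x u) (when (noDup u) X)
    ≡⟨ when-∧ (fresh x u) (noDup u) X ⟨
  when (noDup (x ∷ u)) X ∎
  where open ≡-Reasoning

-- The injections into Fin (suc K) avoiding j are the punchIn j ∘ u with u injective.
Σ-fresh-injections : ∀ L K (j : Fin (suc K)) (H : Vec (Fin (suc K)) L → Poly) →
  concatMap (λ τ → when (fresh j (toList τ) ∧ noDup (toList τ)) (H τ)) (allMaps L (suc K))
  ≋ concatMap (λ u → when (noDup (toList u)) (H (Vec.map (punchIn j) u))) (allMaps L K)
Σ-fresh-injections zero    K j H = ≋-refl
Σ-fresh-injections (suc L) K j H = begin
  concatMap C (allMaps (suc L) (suc K))                 ≡⟨ concatMap-allMaps-suc L (suc K) C ⟩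
  ΣFin T                                                ≈⟨ ΣFin-punchIn T j ⟩
  T j ++ ΣFin (T ∘ punchIn j)                           ≈⟨ ++-cong T-self (ΣFin-cong T-punchIn) ⟩
  ΣFin (λ x → concatMap (R ∘ (x Vec.∷_)) (allMaps L K)) ≡⟨ concatMap-allMaps-suc L K R ⟨
  concatMap R (allMaps (suc L) K)                       ∎
  where
  open ≋-Reasoning
  C : Vec (Fin (suc K)) (suc L) → Poly
  C τ = when (fresh j (toList τ) ∧ noDup (toList τ)) (H τ)
  R : Vec (Fin K) (suc L) → Poly
  R u = when (noDup (toList u)) (H (Vec.map (punchIn j) u))
  T : Fin (suc K) → Poly
  T x = concatMap (C ∘ (x Vec.∷_)) (allMaps L (suc K))

  T-self : T j ≋ []
  T-self = ≡⇒≋ (none (allMaps L (suc K)))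
    where
    none : ∀ τs → concatMap (C ∘ (j Vec.∷_)) τs ≡ []
    none []       = refl
    none (τ ∷ τs) rewrite fresh-∷-self j (toList τ) = none τs

  T-punchIn : ∀ x → T (punchIn j x) ≋ concatMap (R ∘ (x Vec.∷_)) (allMaps L K)
  T-punchIn x = begin
    T (punchIn j x)
      ≈⟨ concatMap-cong (≡⇒≋ ∘ C-punchIn) (allMaps L (suc K)) ⟩
    concatMap (λ τ → when (fresh j (toList τ) ∧ noDup (toList τ)) (H′ τ)) (allMaps L (suc K))
      ≈⟨ Σ-fresh-injections L K j H′ ⟩
    concatMap (λ u → when (noDup (toList u)) (H′ (Vec.map (punchIn j) u))) (allMaps L K)
      ≈⟨ concatMap-cong (≡⇒≋ ∘ R-∷) (allMaps L K) ⟩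
    concatMap (R ∘ (x Vec.∷_)) (allMaps L K) ∎
    where
    H′ : Vec (Fin (suc K)) L → Poly
    H′ τ = when (fresh (punchIn j x) (toList τ)) (H (punchIn j x Vec.∷ τ))

    C-punchIn : ∀ τ → C (punchIn j x Vec.∷ τ) ≡ when (fresh j (toList τ) ∧ noDup (toList τ)) (H′ τ)
    C-punchIn τ = when-fresh-∷-punchIn j x (toList τ) (H (punchIn j x Vec.∷ τ))

    R-∷ : ∀ u → when (noDup (toList u)) (H′ (Vec.map (punchIn j) u)) ≡ R (x Vec.∷ u)
    R-∷ u = trans (cong (λ l → when (noDup (toList u)) (when (fresh (punchIn j x) l) X)) (Vec.toList-map (punchIn j) u))
                  (when-noDup-map-punchIn j x (toList u) X)
      where
      X : Poly
      X = H (punchIn j x Vec.∷ Vec.map (punchIn j) u)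

Σ-Sym-suc : ∀ K (F : Vec (Fin (suc K)) (suc K) → Poly) →
  concatMap F (Sym (suc K)) ≋ ΣFin (λ j → concatMap (λ u → F (j Vec.∷ Vec.map (punchIn j) u)) (Sym K))
Σ-Sym-suc K F = begin
  concatMap F (Sym (suc K))
    ≡⟨ concatMap-filter (noDup ∘ toList) F (allMaps (suc K) (suc K)) ⟩
  concatMap (λ σ → when (noDup (toList σ)) (F σ)) (allMaps (suc K) (suc K))
    ≡⟨ concatMap-allMaps-suc K (suc K) (λ σ → when (noDup (toList σ)) (F σ)) ⟩
  ΣFin (λ j → concatMap (λ τ → when (fresh j (toList τ) ∧ noDup (toList τ)) (F (j Vec.∷ τ))) (allMaps K (suc K)))
    ≈⟨ ΣFin-cong (λ j → Σ-fresh-injections K K j (F ∘ (j Vec.∷_))) ⟩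
  ΣFin (λ j → concatMap (λ u → when (noDup (toList u)) (F (j Vec.∷ Vec.map (punchIn j) u))) (allMaps K K))
    ≈⟨ ΣFin-cong (λ j → ≡⇒≋ (concatMap-filter (noDup ∘ toList) (F ∘ (j Vec.∷_) ∘ Vec.map (punchIn j)) (allMaps K K))) ⟨
  ΣFin (λ j → concatMap (λ u → F (j Vec.∷ Vec.map (punchIn j) u)) (Sym K)) ∎
  where open ≋-Reasoning

alt-tabulate : ∀ {K} f (a : Fin (suc K) → ℕ) →
  alt f (tabulate a) ≋ ΣFin (λ j → scale (minusOnePow (toℕ j)) (f (a j) (tabulate (a ∘ punchIn j))))
alt-tabulate {zero}  f a = ++-congʳ [] (≡⇒≋ (sym (scale-1 (f (a zero) []))))
alt-tabulate {suc K} f a = ++-cong (≡⇒≋ (sym (scale-1 (f (a zero) (tabulate (a ∘ suc)))))) (begin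
  neg (alt f′ (tabulate (a ∘ suc)))
    ≈⟨ neg-cong (alt-tabulate f′ (a ∘ suc)) ⟩
  neg (ΣFin G)
    ≈⟨ linear-ΣFin neg-linear G ⟩
  ΣFin (neg ∘ G)
    ≈⟨ ΣFin-cong (λ j → ≡⇒≋ (neg-scale (minusOnePow (toℕ j)) (f′ (a (suc j)) (tabulate (a ∘ suc ∘ punchIn j))))) ⟩
  ΣFin (λ j → scale (minusOnePow (toℕ (suc j))) (f (a (suc j)) (tabulate (a ∘ punchIn (suc j))))) ∎)
  where
  open ≋-Reasoning
  f′ : ℕ → List ℕ → Poly
  f′ y ys = f y (a zero ∷ ys)
  G : Fin (suc K) → Poly
  G j = scale (minusOnePow (toℕ j)) (f′ (a (suc j)) (tabulate (a ∘ suc ∘ punchIn j)))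

interleave-cong : ∀ {n} {c c′ : Fin (suc n) → ℕ} → (∀ i → c i ≡ c′ i) → ∀ b →
                  interleave c b ≡ interleave c′ b
interleave-cong {zero}  c≗c′ b = cong (_∷ []) (c≗c′ zero)
interleave-cong {suc n} c≗c′ b =
  cong₂ (λ x w → x ∷ b zero ∷ w) (c≗c′ zero) (interleave-cong (c≗c′ ∘ suc) (b ∘ suc))

altSum≋altInterleave : ∀ n a b → altSum n a b ≋ altInterleave (tabulate a) (tabulate b)
altSum≋altInterleave zero    a b = ≋-refl
altSum≋altInterleave (suc n) a b = begin
  altSum (suc n) a b
    ≡⟨ map-as-concatMap _ (Sym (suc (suc n))) ⟩
  concatMap (term a b) (Sym (suc (suc n)))
    ≈⟨ Σ-Sym-suc (suc n) (term a b) ⟩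
  ΣFin (λ j → concatMap (λ u → term a b (j Vec.∷ Vec.map (punchIn j) u)) (Sym (suc n)))
    ≈⟨ ΣFin-cong (λ j → concatMap-cong-All (λ {u} → ≡⇒≋ ∘ term-punchIn j u)
                                             (All.all-filter (λ σ → noDup (toList σ) Bool.≟ true) (allMaps (suc n) (suc n)))) ⟩
  ΣFin (λ j → concatMap (L j ∘ term (a ∘ punchIn j) (b ∘ suc)) (Sym (suc n)))
    ≈⟨ ΣFin-cong (λ j → linear-concatMap (L-linear j) (term (a ∘ punchIn j) (b ∘ suc)) (Sym (suc n))) ⟨
  ΣFin (λ j → L j (concatMap (term (a ∘ punchIn j) (b ∘ suc)) (Sym (suc n))))
    ≈⟨ ΣFin-cong (λ j → L-cong j (≋-trans (≡⇒≋ (sym (map-as-concatMap _ (Sym (suc n)))))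
                                           (altSum≋altInterleave n (a ∘ punchIn j) (b ∘ suc)))) ⟩
  ΣFin (λ j → L j (altInterleave (tabulate (a ∘ punchIn j)) (tabulate (b ∘ suc))))
    ≈⟨ alt-tabulate (λ y ys → prefix y (prefix (b zero) (altInterleave ys (tabulate (b ∘ suc))))) a ⟨
  altInterleave (tabulate a) (tabulate b) ∎
  where
  open ≋-Reasoning
  term : ∀ {m} → (Fin (suc m) → ℕ) → (Fin m → ℕ) → Vec (Fin (suc m)) (suc m) → Poly
  term a b σ = (sgn σ , interleave (a ∘ lookup σ) b) ∷ []
  L : Fin (suc (suc n)) → Poly → Poly
  L j = scale (minusOnePow (toℕ j)) ∘ prefix (a j) ∘ prefix (b zero)
  L-linear : ∀ j → Linear (L j)
  L-linear j = ∘-linear (scale-cong (minusOnePow (toℕ j))) (scale-linear (minusOnePow (toℕ j)))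
                        (∘-linear (prefix-cong (a j)) (prefix-linear (a j)) (prefix-linear (b zero)))
  L-cong : ∀ j {p q} → p ≋ q → L j p ≋ L j q
  L-cong j = scale-cong (minusOnePow (toℕ j)) ∘ prefix-cong (a j) ∘ prefix-cong (b zero)
  term-punchIn : ∀ j u → noDup (toList u) ≡ true →
                 term a b (j Vec.∷ Vec.map (punchIn j) u) ≡ L j (term (a ∘ punchIn j) (b ∘ suc) u)
  term-punchIn j u u-noDup = cong₂ (λ c w → (c , a j ∷ b zero ∷ w) ∷ []) (sgn-punchIn j u u-noDup)
    (interleave-cong (λ i → cong a (Vec.lookup-map i (punchIn j) u)) (b ∘ suc))

proposition2p2 : (n : ℕ) → 1 ≤ n → (a : Fin (suc n) → ℕ) → (b : Fin n → ℕ) →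
                 (∀ i → 1 ≤ a i) → (∀ i → 1 ≤ b i) →
                 InBlockSpan (altSum n a b)
proposition2p2 (suc n) _ a b a≥1 b≥1 =
  InBlockSpan-resp (≋-sym expansion) (alt-closed InBlockSpan-closed F (All.tabulate⁺ a≥1) F-in-span)
  where
  b′ : List ℕ
  b′ = tabulate (b ∘ suc)
  F : ℕ → List ℕ → Poly
  F y ys = letter y ⋄ prefix (b zero) (altInterleave ys b′)
  expansion : altSum (suc n) a b ≋ alt F (tabulate a)
  expansion = ≋-trans (altSum≋altInterleave (suc n) a b) (altInterleave≋alt-letter⋄ (b zero) b′ (tabulate a))
  F-in-span : ∀ {y ys} → 1 ≤ y → All (1 ≤_) ys → InBlockSpan (F y ys)
  F-in-span y≥1 ys≥1 = InBlockSpan-⋄ (InX⁺-prefix {p = word []} y≥1 ([] ∷ []))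
    (InX⁺-prefix (b≥1 zero) (AllLetters-altInterleave b′ ys≥1 (All.tabulate⁺ (b≥1 ∘ suc))))
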